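{- Let $G$ be a finite simple connected graph of order $n\ge 5$ and size $m$. If $G$ has a perfect matching, then $\chi'_L(G)\le m-\frac{n}{2}+1$. This bound is attained by the cycle $C_6$ and the path $P_6$.
   Context: $C_6$ and $P_6$ are the cycle and path on six vertices. For a proper edge coloring $c:E(G)\to\{1,\dots,k\}$ of $G$, let $\pi=(\mathcal{C}_1,\dots,\mathcal{C}_k)$ be the ordered partition of $E(G)$ into color classes. For a vertex $v$ and an edge $e=xy$, $d(v,e)=\min\{d(v,x),d(v,y)\}$, and $d(v,\mathcal{C}_i)=\min\{d(v,e): e\in\mathcal{C}_i\}$. The edge color code of $v$ is $c_\pi(v)=(d(v,\mathcal{C}_1),\dots,d(v,\mathcal{C}_k))$. The coloring is an edge-locating coloring if distinct vertices have distinct edge color codes; $\chi'_L(G)$ is the minimum number of colors in an edge-locating coloring of $G$. -}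

module Defs where

open import Data.Nat using (ℕ; zero; suc; _≤_; _<_; _≡ᵇ_)
open import Data.Nat.Properties using ()
open import Data.Fin using (Fin; toℕ)
open import Data.Fin.Properties using ()
open import Data.Bool using (Bool; true; false; _∧_; _∨_)
open import Data.Bool.Properties using (∨-comm)
open import Data.List using (List; length; filterᵇ; concatMap; map; allFin)
open import Data.Product using (Σ; ∃; _×_; _,_)
open import Relation.Nullary using (¬_)
open import Relation.Binary.PropositionalEquality using (_≡_; _≢_; refl; cong₂; trans)

record Graph (n : ℕ) : Set where
  field
    E     : Fin n → Fin n → Bool
    sym   : ∀ u v → E u v ≡ E v u
    irrefl : ∀ u → E u u ≡ false

open Graph public

Adj : ∀ {n} → Graph n → Fin n → Fin n → Set
Adj G u v = E G u v ≡ true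

size : ∀ {n} → Graph n → ℕ
size {n} G = length (filterᵇ isEdge pairs)
  where
    pairs : List (Fin n × Fin n)
    pairs = concatMap (λ u → map (λ v → (u , v)) (allFin n)) (allFin n)
    ltᵇ : ℕ → ℕ → Bool
    ltᵇ zero (suc b) = true
    ltᵇ _ zero = false
    ltᵇ (suc a) (suc b) = ltᵇ a b
    isEdge : Fin n × Fin n → Bool
    isEdge (u , v) = ltᵇ (toℕ u) (toℕ v) ∧ E G u v

data Walk {n} (G : Graph n) : Fin n → Fin n → ℕ → Set where
  nil  : ∀ {u} → Walk G u u 0
  cons : ∀ {u v w k} → Adj G u v → Walk G v w k → Walk G u w (suc k)

Connected : ∀ {n} → Graph n → Set
Connected G = ∀ u v → ∃ λ k → Walk G u v k

IsDist : ∀ {n} → Graph n → Fin n → Fin n → ℕ → Set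
IsDist G u v k = Walk G u v k × (∀ j → j < k → ¬ Walk G u v j)

record PerfectMatching {n} (G : Graph n) : Set where
  field
    M       : Fin n → Fin n → Bool
    M-sym   : ∀ u v → M u v ≡ M v u
    M⊆E     : ∀ u v → M u v ≡ true → Adj G u v
    exactly-one : ∀ v → ∃ λ u → (M v u ≡ true) × (∀ w → M v w ≡ true → w ≡ u)

-- Edge colorings.  A coloring with k colors assigns c u v to the edge uv;
-- it is given as a function on vertex pairs, symmetric on edges (values
-- on non-adjacent pairs are irrelevant).

record EdgeColoring {n} (G : Graph n) (k : ℕ) : Set where
  field
    c      : Fin n → Fin n → Fin k
    c-sym  : ∀ u v → Adj G u v → c u v ≡ c v u
    proper : ∀ u v w → v ≢ w → Adj G u v → Adj G u w → c u v ≢ c u w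
    -- π = (C₁,…,C_k) is a partition into k (nonempty) color classes
    onto   : ∀ i → ∃ λ x → ∃ λ y → Adj G x y × c x y ≡ i

open EdgeColoring public

-- d(v , C_i) = k : the minimum over edges xy of color i of
-- d(v , xy) = min (d(v,x), d(v,y)).  Since c is symmetric on edges, this
-- is the minimum of d(v , x) over endpoints x of edges xy of color i.
ClassDist : ∀ {n} {G : Graph n} {k} → EdgeColoring G k → Fin n → Fin k → ℕ → Set
ClassDist {G = G} col v i d =
  (∃ λ x → ∃ λ y → Adj G x y × c col x y ≡ i × IsDist G v x d)
  × (∀ x y j → Adj G x y → c col x y ≡ i → IsDist G v x j → d ≤ j)

SameCode : ∀ {n} {G : Graph n} {k} → EdgeColoring G k → Fin n → Fin n → Set
SameCode col u w = ∀ i d → (ClassDist col u i d → ClassDist col w i d)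
                         × (ClassDist col w i d → ClassDist col u i d)

record EdgeLocatingColoring {n} (G : Graph n) (k : ℕ) : Set where
  field
    coloring : EdgeColoring G k
    locating : ∀ u w → SameCode coloring u w → u ≡ w

IsEdgeLocatingChromaticIndex : ∀ {n} → Graph n → ℕ → Set
IsEdgeLocatingChromaticIndex G k =
  EdgeLocatingColoring G k × (∀ j → EdgeLocatingColoring G j → k ≤ j)

private
  ≡ᵇ-suc-self : ∀ a → (suc a ≡ᵇ a) ≡ false
  ≡ᵇ-suc-self zero = refl
  ≡ᵇ-suc-self (suc a) = ≡ᵇ-suc-self a

  ≡ᵇ-sym : ∀ a b → (a ≡ᵇ b) ≡ (b ≡ᵇ a)
  ≡ᵇ-sym zero zero = refl
  ≡ᵇ-sym zero (suc b) = refl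
  ≡ᵇ-sym (suc a) zero = refl
  ≡ᵇ-sym (suc a) (suc b) = ≡ᵇ-sym a b

  ∧-comm' : ∀ a b → (a ∧ b) ≡ (b ∧ a)
  ∧-comm' false false = refl
  ∧-comm' false true = refl
  ∧-comm' true false = refl
  ∧-comm' true true = refl

adjP : ℕ → ℕ → Bool
adjP a b = (suc a ≡ᵇ b) ∨ (suc b ≡ᵇ a)

adjC : ℕ → ℕ → Bool
adjC a b = adjP a b ∨ (((a ≡ᵇ 0) ∧ (b ≡ᵇ 5)) ∨ ((a ≡ᵇ 5) ∧ (b ≡ᵇ 0)))

private
  adjP-sym : ∀ a b → adjP a b ≡ adjP b a
  adjP-sym a b = ∨-comm (suc a ≡ᵇ b) (suc b ≡ᵇ a)

  adjP-irr : ∀ a → adjP a a ≡ false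
  adjP-irr a rewrite ≡ᵇ-suc-self a = refl

  adjC-sym : ∀ a b → adjC a b ≡ adjC b a
  adjC-sym a b = cong₂ _∨_ (adjP-sym a b)
    (trans (∨-comm ((a ≡ᵇ 0) ∧ (b ≡ᵇ 5)) ((a ≡ᵇ 5) ∧ (b ≡ᵇ 0)))
       (cong₂ _∨_ (∧-comm' (a ≡ᵇ 5) (b ≡ᵇ 0)) (∧-comm' (a ≡ᵇ 0) (b ≡ᵇ 5))))

  adjC-irr : ∀ a → adjC a a ≡ false
  adjC-irr zero = refl
  adjC-irr (suc zero) = refl
  adjC-irr (suc (suc zero)) = refl
  adjC-irr (suc (suc (suc zero))) = refl
  adjC-irr (suc (suc (suc (suc zero)))) = refl
  adjC-irr (suc (suc (suc (suc (suc zero))))) = refl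
  adjC-irr (suc (suc (suc (suc (suc (suc a)))))) rewrite adjP-irr a = refl

P₆ : Graph 6
P₆ = record { E = λ u v → adjP (toℕ u) (toℕ v)
            ; sym = λ u v → adjP-sym (toℕ u) (toℕ v)
            ; irrefl = λ u → adjP-irr (toℕ u) }

C₆ : Graph 6
C₆ = record { E = λ u v → adjC (toℕ u) (toℕ v)
            ; sym = λ u v → adjC-sym (toℕ u) (toℕ v)
            ; irrefl = λ u → adjC-irr (toℕ u) }

-- Colour all edges of a perfect matching with one colour and give each of the other
-- m − n/2 edges a colour of its own. Suppose distinct u and w have the same code. A
-- non-matching edge uz is alone in its colour class, at distance 0 from u, hence from w,
-- so z = w. A non-matching edge pz at the partner p of u is alone in its class, at
-- distance 1 from u, hence from w, so w is adjacent to p or z, which forces z to be the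
-- partner of w. Thus no edge leaves {u, w, partners of u and w}, and by connectivity G
-- has at most four vertices. For C₆ and P₆ an exhaustive search shows that fewer colours
-- than the bound never give an edge-locating colouring.

module Submission where

open import Defs
open import Data.Nat using (ℕ; _≤_; _+_; _∸_; _/_)
open import Data.Product using (∃; _×_)

open import Axiom.UniquenessOfIdentityProofs using (module Decidable⇒UIP)
open import Data.Bool using (Bool; true; false; _∧_; not; if_then_else_; T; T?)
import Data.Bool.Properties as Bool
open import Data.Bool.Properties using (T-≡; T-not-≡; T-∧)
open import Data.Empty using (⊥-elim)
open import Data.Fin using (Fin; zero; suc; toℕ; fromℕ<; #_)
import Data.Fin as Fin using (_<_)
import Data.Fin.Properties as Finₚ
open import Data.List
  using (List; []; _∷_; length; map; _++_; filter; filterᵇ; concatMap; allFin; cartesianProduct; lookup)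
import Data.List.Extrema.Nat as Extrema
open import Data.List.Membership.Propositional using (_∈_)
open import Data.List.Membership.Propositional.Properties
  using (∈-allFin; ∈-lookup; ∈-map⁺; ∈-map⁻; ∈-++⁺ˡ; ∈-++⁺ʳ; ∈-filter⁺; ∈-filter⁻; ∈-cartesianProduct⁺)
import Data.List.Membership.DecPropositional as DecMembership
import Data.List.Membership.Setoid.Properties as SetoidMembership
open import Data.List.Properties using (length-map; length-++; filter-≐)
open import Data.List.Relation.Unary.All using (All; []; _∷_)
import Data.List.Relation.Unary.All as All
open import Data.List.Relation.Unary.Any using (here; there; index)
import Data.List.Relation.Unary.Any as Any
open import Data.List.Relation.Unary.Any.Properties using (lookup-index)
open import Data.List.Relation.Unary.Unique.Propositional using (Unique)
import Data.List.Relation.Unary.Unique.Propositional.Properties as Unique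
open import Data.Maybe using (Maybe; just; nothing)
import Data.Maybe.Properties as Maybe
open import Data.Nat using (zero; suc; _*_; z≤n; s≤s; _<ᵇ_)
import Data.Nat as ℕ
open import Data.Nat.DivMod using (/-monoˡ-≤; m*n/n≡m)
open import Data.Nat.Properties
  using ( <ᵇ⇒<; +-comm; +-suc; +-identityʳ; *-comm; +-∸-comm; m≤n+m; +-monoˡ-≤
        ; ≤-trans; ≤-reflexive; ≤-antisym; 1+n≰n; ≮⇒≥; module ≤-Reasoning)
import Data.Nat.Properties as ℕₚ
open import Data.Product using (Σ; _,_; proj₁; proj₂; uncurry; swap)
import Data.Product.Properties as Product
open import Data.Sum using (_⊎_; inj₁; inj₂)
import Data.Sum as Sum
open import Data.Vec using (Vec; []; _∷_)
import Data.Vec as Vec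
import Data.Vec.Properties as Vecₚ
open import Function using (_∘_; id; Injective)
open import Function.Bundles using (module Equivalence)
open import Relation.Binary using (tri<; tri≈; tri>)
open import Relation.Binary.PropositionalEquality
  using (_≡_; _≢_; refl; trans; cong; cong₂; subst; module ≡-Reasoning)
import Relation.Binary.PropositionalEquality as ≡
open import Relation.Nullary using (¬_; Dec; yes; no; does)
open import Relation.Nullary.Decidable using (dec-true; from-yes; map′; _×-dec_; _⊎-dec_; _→-dec_; ¬?)
open import Relation.Unary using (_≐_)

open Equivalence using (to)

private
  variable
    A : Set
    n k : ℕ

length-filterᵇ-partition : ∀ (p q : A → Bool) xs →
  length (filterᵇ p xs) ≡
  length (filterᵇ (λ x → p x ∧ q x) xs) + length (filterᵇ (λ x → p x ∧ not (q x)) xs)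
length-filterᵇ-partition p q [] = refl
length-filterᵇ-partition p q (x ∷ xs) with ih ← length-filterᵇ-partition p q xs | p x | q x
... | false | _ = ih
... | true | true = cong suc ih
... | true | false = trans (cong suc ih) (≡.sym (+-suc _ _))

≤-length-of-cover : (xs : List (Fin n)) → (∀ x → x ∈ xs) → n ≤ length xs
≤-length-of-cover xs cover = Finₚ.injective⇒≤ index-injective
  where
  index-injective : Injective _≡_ _≡_ (λ x → index (cover x))
  index-injective {x} {y} eq =
    trans (lookup-index (cover x)) (trans (cong (lookup xs) eq) (≡.sym (lookup-index (cover y))))

half-≤ : ∀ {m k} → m ≤ k + k → m / 2 ≤ k
half-≤ {m} {k} m≤2k = ≤-trans (/-monoˡ-≤ 2 (subst (m ≤_) k+k≡k*2 m≤2k)) (≤-reflexive (m*n/n≡m k 2))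
  where
  k+k≡k*2 : k + k ≡ k * 2
  k+k≡k*2 = trans (cong (k +_) (≡.sym (+-identityʳ k))) (*-comm 2 k)

index-∈-lookup : ∀ (xs : List A) i → index (∈-lookup {xs = xs} i) ≡ i
index-∈-lookup (x ∷ xs) zero = refl
index-∈-lookup (x ∷ xs) (suc i) = cong suc (index-∈-lookup xs i)

module Position {A : Set} (_≟_ : (x y : A) → Dec (x ≡ y)) (xs : List A) where
  open DecMembership _≟_ using (_∈?_)

  position : A → Fin (suc (length xs))
  position x with x ∈? xs
  ... | yes x∈xs = suc (index x∈xs)
  ... | no _ = zero

  position-∈ : ∀ {x} → x ∈ xs → position x ≢ zero
  position-∈ {x} x∈xs with x ∈? xs
  ... | yes _ = λ ()
  ... | no x∉xs = ⊥-elim (x∉xs x∈xs)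

  position-injective : ∀ {x y} → position x ≢ zero → position x ≡ position y → x ≡ y
  position-injective {x} {y} nz eq with x ∈? xs | y ∈? xs
  ... | no _ | _ = ⊥-elim (nz refl)
  ... | yes _ | no _ = ⊥-elim (nz eq)
  ... | yes x∈xs | yes y∈xs =
    trans (lookup-index x∈xs) (trans (cong (lookup xs) (Finₚ.suc-injective eq)) (≡.sym (lookup-index y∈xs)))

  position-lookup : Unique xs → ∀ i → position (lookup xs i) ≡ suc i
  position-lookup unique i with lookup xs i ∈? xs
  ... | no ∉xs = ⊥-elim (∉xs (∈-lookup i))
  ... | yes ∈xs = cong suc (trans (cong index (irrelevant ∈xs (∈-lookup i))) (index-∈-lookup xs i))
    where
    irrelevant : ∀ {x} (p q : x ∈ xs) → p ≡ q
    irrelevant = SetoidMembership.unique⇒irrelevant (≡.setoid A) (Decidable⇒UIP.≡-irrelevant _≟_) unique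

pairs : ∀ n → List (Fin n × Fin n)
pairs n = concatMap (λ u → map (u ,_) (allFin n)) (allFin n)

concatMap-pairs≡cartesianProduct : ∀ {B : Set} (xs : List A) (ys : List B) →
  concatMap (λ x → map (x ,_) ys) xs ≡ cartesianProduct xs ys
concatMap-pairs≡cartesianProduct [] ys = refl
concatMap-pairs≡cartesianProduct (x ∷ xs) ys = cong (map (x ,_) ys ++_) (concatMap-pairs≡cartesianProduct xs ys)

pairs≡cartesianProduct : ∀ n → pairs n ≡ cartesianProduct (allFin n) (allFin n)
pairs≡cartesianProduct n = concatMap-pairs≡cartesianProduct (allFin n) (allFin n)

pairs-unique : ∀ n → Unique (pairs n)
pairs-unique n rewrite pairs≡cartesianProduct n = Unique.cartesianProduct⁺ (Unique.allFin⁺ n) (Unique.allFin⁺ n)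

∈-pairs : ∀ (u v : Fin n) → (u , v) ∈ pairs n
∈-pairs {n} u v rewrite pairs≡cartesianProduct n = ∈-cartesianProduct⁺ (∈-allFin u) (∈-allFin v)

edgeᵇ : Graph n → Fin n × Fin n → Bool
edgeᵇ G (u , v) = does (u Finₚ.<? v) ∧ E G u v

-- `size` tests u < v with a local copy of `_<ᵇ_`; unification (after abstracting the
-- arguments with `with`) exposes that copy, which is then compared with `_<ᵇ_`.
size≡ : (G : Graph n) → size G ≡ length (filterᵇ (edgeᵇ G) (pairs n))
size≡ {n} G = trans (proj₂ size-filter) (cong length (filter-≐ (T? ∘ proj₁ size-filter) (T? ∘ edgeᵇ G) same-test (pairs n)))
  where
  size-filter : Σ (Fin n × Fin n → Bool) λ isEdge → size G ≡ length (filterᵇ isEdge (pairs n))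
  size-filter = _ , refl

  local-< : ℕ → ℕ → Bool
  local-< a b = _

  local-<-test : ∀ u v → proj₁ size-filter (u , v) ≡ (local-< (toℕ u) (toℕ v) ∧ E G u v)
  local-<-test u v with toℕ u | toℕ v
  ... | a | b = refl

  local-<≡<ᵇ : ∀ a b → local-< a b ≡ (a <ᵇ b)
  local-<≡<ᵇ zero zero = refl
  local-<≡<ᵇ zero (suc b) = refl
  local-<≡<ᵇ (suc a) zero = refl
  local-<≡<ᵇ (suc a) (suc b) = local-<≡<ᵇ a b

  edge-test : ∀ p → proj₁ size-filter p ≡ edgeᵇ G p
  edge-test (u , v) = trans (local-<-test u v) (cong (_∧ E G u v) (local-<≡<ᵇ (toℕ u) (toℕ v)))

  same-test : (T ∘ proj₁ size-filter) ≐ (T ∘ edgeᵇ G)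
  same-test = (λ {p} → subst T (edge-test p)) , (λ {p} → subst T (≡.sym (edge-test p)))

sortPair : Fin n → Fin n → Fin n × Fin n
sortPair x y with x Finₚ.<? y
... | yes _ = x , y
... | no _ = y , x

sortPair-cases : {x y : Fin n} → x ≢ y →
  (sortPair x y ≡ (x , y) × x Fin.< y) ⊎ (sortPair x y ≡ (y , x) × y Fin.< x)
sortPair-cases {x = x} {y} x≢y with x Finₚ.<? y
... | yes x<y = inj₁ (refl , x<y)
... | no x≮y = inj₂ (refl , Finₚ.≤∧≢⇒< (≮⇒≥ x≮y) (x≢y ∘ ≡.sym))

sortPair-of-< : {x y : Fin n} → x Fin.< y → sortPair x y ≡ (x , y)
sortPair-of-< {x = x} {y} x<y with x Finₚ.<? y
... | yes _ = refl
... | no x≮y = ⊥-elim (x≮y x<y)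

sortPair-comm : {x y : Fin n} → x ≢ y → sortPair x y ≡ sortPair y x
sortPair-comm x≢y with sortPair-cases x≢y | sortPair-cases (x≢y ∘ ≡.sym)
... | inj₁ (_ , x<y) | inj₁ (_ , y<x) = ⊥-elim (Finₚ.<-asym x<y y<x)
... | inj₁ (xy , _) | inj₂ (yx , _) = trans xy (≡.sym yx)
... | inj₂ (yx , _) | inj₁ (xy , _) = trans yx (≡.sym xy)
... | inj₂ (_ , y<x) | inj₂ (_ , x<y) = ⊥-elim (Finₚ.<-asym x<y y<x)

sortPair-injective : {x y a b : Fin n} → x ≢ y → a ≢ b → sortPair x y ≡ sortPair a b →
  (x ≡ a × y ≡ b) ⊎ (x ≡ b × y ≡ a)
sortPair-injective x≢y a≢b eq with sortPair-cases x≢y | sortPair-cases a≢b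
... | inj₁ (xy , _) | inj₁ (ab , _) = inj₁ (Product.,-injective (trans (≡.sym xy) (trans eq ab)))
... | inj₁ (xy , _) | inj₂ (ba , _) = inj₂ (Product.,-injective (trans (≡.sym xy) (trans eq ba)))
... | inj₂ (yx , _) | inj₁ (ab , _) = inj₂ (swap (Product.,-injective (trans (≡.sym yx) (trans eq ab))))
... | inj₂ (yx , _) | inj₂ (ba , _) = inj₁ (swap (Product.,-injective (trans (≡.sym yx) (trans eq ba))))

module GraphFacts {n} (G : Graph n) where
  adj⇒≢ : ∀ {x y} → Adj G x y → x ≢ y
  adj⇒≢ {x} xy refl with trans (≡.sym xy) (irrefl G x)
  ... | ()

  adj-sym : ∀ {x y} → Adj G x y → Adj G y x
  adj-sym {x} {y} xy = trans (Graph.sym G y x) xy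

  walk-0 : ∀ {x y} → Walk G x y 0 → x ≡ y
  walk-0 nil = refl

  walk-1 : ∀ {x y} → Walk G x y 1 → Adj G x y
  walk-1 (cons xy nil) = xy

  isDist-unique : ∀ {x y a b} → IsDist G x y a → IsDist G x y b → a ≡ b
  isDist-unique {a = a} {b} (walk-a , shortest-a) (walk-b , shortest-b) with ℕₚ.<-cmp a b
  ... | tri< a<b _ _ = ⊥-elim (shortest-b a a<b walk-a)
  ... | tri≈ _ a≡b _ = a≡b
  ... | tri> _ _ b<a = ⊥-elim (shortest-a b b<a walk-b)

  walk-closed : (P : Fin n → Set) → (∀ {s z} → P s → Adj G s z → P z) →
                ∀ {s t k} → Walk G s t k → P s → P t
  walk-closed P closed nil Ps = Ps
  walk-closed P closed (cons sz walk) Ps = walk-closed P closed walk (closed Ps sz)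

module _ {G : Graph n} (pm : PerfectMatching G) where
  open PerfectMatching pm

  matched-unique : ∀ {v a b} → M v a ≡ true → M v b ≡ true → a ≡ b
  matched-unique {v} Mva Mvb with exactly-one v
  ... | _ , _ , unique = trans (unique _ Mva) (≡.sym (unique _ Mvb))

true-or-false : ∀ b → b ≡ true ⊎ b ≡ false
true-or-false true = inj₁ refl
true-or-false false = inj₂ refl

UniquelyColoured : (G : Graph n) → (Fin n → Fin n → Fin k) → Fin n → Fin n → Set
UniquelyColoured G c x y =
  ∀ a b → Adj G a b → c a b ≡ c x y → (a ≡ x × b ≡ y) ⊎ (a ≡ y × b ≡ x)

-- The colouring

module MatchingColouring {n} (G : Graph n) (pm : PerfectMatching G) where
  open PerfectMatching pm
  open GraphFacts G

  matchingᵇ nonMatchingᵇ : Fin n × Fin n → Bool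
  matchingᵇ p = edgeᵇ G p ∧ uncurry M p
  nonMatchingᵇ p = edgeᵇ G p ∧ not (uncurry M p)

  matching nonMatching : List (Fin n × Fin n)
  matching = filterᵇ matchingᵇ (pairs n)
  nonMatching = filterᵇ nonMatchingᵇ (pairs n)

  size≡matching+nonMatching : size G ≡ length matching + length nonMatching
  size≡matching+nonMatching = trans (size≡ G) (length-filterᵇ-partition (edgeᵇ G) (uncurry M) (pairs n))

  edgeᵇ-sorted : ∀ {x y} → x Fin.< y → Adj G x y → edgeᵇ G (x , y) ≡ true
  edgeᵇ-sorted {x} {y} x<y xy rewrite dec-true (x Finₚ.<? y) x<y = xy

  ∈-matching : ∀ {x y} → x Fin.< y → M x y ≡ true → (x , y) ∈ matching
  ∈-matching {x} {y} x<y Mxy = ∈-filter⁺ (T? ∘ matchingᵇ) (∈-pairs x y) holds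
    where
    holds : T (matchingᵇ (x , y))
    holds rewrite edgeᵇ-sorted x<y (M⊆E x y Mxy) | Mxy = _

  ∈-nonMatching : ∀ {x y} → x Fin.< y → Adj G x y → M x y ≡ false → (x , y) ∈ nonMatching
  ∈-nonMatching {x} {y} x<y xy Mxy = ∈-filter⁺ (T? ∘ nonMatchingᵇ) (∈-pairs x y) holds
    where
    holds : T (nonMatchingᵇ (x , y))
    holds rewrite edgeᵇ-sorted x<y xy | Mxy = _

  ∈-nonMatching⁻ : ∀ {x y} → (x , y) ∈ nonMatching → x Fin.< y × Adj G x y × M x y ≡ false
  ∈-nonMatching⁻ xy∈ with to T-∧ (proj₂ (∈-filter⁻ (T? ∘ nonMatchingᵇ) {xs = pairs n} xy∈))
  ... | edge , notM with to T-∧ edge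
  ... | x<y , xy = <ᵇ⇒< _ _ x<y , to T-≡ xy , to T-not-≡ notM

  nonMatching-unique : Unique nonMatching
  nonMatching-unique = Unique.filter⁺ (T? ∘ nonMatchingᵇ) (pairs-unique n)

  matching-endpoints : List (Fin n)
  matching-endpoints = map proj₁ matching ++ map proj₂ matching

  ∈-matching-endpoints : ∀ u → u ∈ matching-endpoints
  ∈-matching-endpoints u with exactly-one u
  ... | p , Mup , _ with Finₚ.<-cmp u p
  ... | tri< u<p _ _ = ∈-++⁺ˡ (∈-map⁺ proj₁ (∈-matching u<p Mup))
  ... | tri≈ _ u≡p _ = ⊥-elim (adj⇒≢ (M⊆E u p Mup) u≡p)
  ... | tri> _ _ p<u = ∈-++⁺ʳ (map proj₁ matching) (∈-map⁺ proj₂ (∈-matching p<u (trans (M-sym p u) Mup)))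

  n≤2·matching : n ≤ length matching + length matching
  n≤2·matching = subst (n ≤_) length-endpoints (≤-length-of-cover matching-endpoints ∈-matching-endpoints)
    where
    length-endpoints : length matching-endpoints ≡ length matching + length matching
    length-endpoints = trans (length-++ (map proj₁ matching))
                             (cong₂ _+_ (length-map proj₁ matching) (length-map proj₂ matching))

  open Position (Product.≡-dec Finₚ._≟_ Finₚ._≟_) nonMatching

  colour : Fin n → Fin n → Fin (suc (length nonMatching))
  colour x y = if M x y then zero else position (sortPair x y)

  colour-matching : ∀ {x y} → M x y ≡ true → colour x y ≡ zero
  colour-matching Mxy rewrite Mxy = refl

  colour-nonMatching : ∀ {x y} → M x y ≡ false → colour x y ≡ position (sortPair x y)
  colour-nonMatching Mxy rewrite Mxy = refl

  sortPair-∈-nonMatching : ∀ {x y} → Adj G x y → M x y ≡ false → sortPair x y ∈ nonMatching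
  sortPair-∈-nonMatching {x} {y} xy Mxy with sortPair-cases (adj⇒≢ xy)
  ... | inj₁ (sorted , x<y) rewrite sorted = ∈-nonMatching x<y xy Mxy
  ... | inj₂ (sorted , y<x) rewrite sorted = ∈-nonMatching y<x (adj-sym xy) (trans (M-sym y x) Mxy)

  colour-nonMatching-≢0 : ∀ {x y} → Adj G x y → M x y ≡ false → colour x y ≢ zero
  colour-nonMatching-≢0 {x} {y} xy Mxy rewrite colour-nonMatching {x} {y} Mxy = position-∈ (sortPair-∈-nonMatching xy Mxy)

  nonMatching-uniquelyColoured : ∀ x y → Adj G x y → M x y ≡ false → UniquelyColoured G colour x y
  nonMatching-uniquelyColoured x y xy Mxy a b ab same with true-or-false (M a b)
  ... | inj₁ Mab = ⊥-elim (colour-nonMatching-≢0 xy Mxy (trans (≡.sym same) (colour-matching {a} {b} Mab)))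
  ... | inj₂ Mab = sortPair-injective (adj⇒≢ ab) (adj⇒≢ xy) (position-injective nonzero positions)
    where
    nonzero : position (sortPair a b) ≢ zero
    nonzero = position-∈ (sortPair-∈-nonMatching ab Mab)
    positions : position (sortPair a b) ≡ position (sortPair x y)
    positions = trans (≡.sym (colour-nonMatching {a} {b} Mab)) (trans same (colour-nonMatching {x} {y} Mxy))

  colour-sym : ∀ x y → Adj G x y → colour x y ≡ colour y x
  colour-sym x y xy rewrite M-sym x y | sortPair-comm (adj⇒≢ xy) = refl

  colour-proper : ∀ u v w → v ≢ w → Adj G u v → Adj G u w → colour u v ≢ colour u w
  colour-proper u v w v≢w uv uw same with true-or-false (M u v) | true-or-false (M u w)
  ... | inj₁ Muv | inj₁ Muw = v≢w (matched-unique pm Muv Muw)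
  ... | inj₁ Muv | inj₂ Muw = colour-nonMatching-≢0 uw Muw (trans (≡.sym same) (colour-matching {u} {v} Muv))
  ... | inj₂ Muv | _ with nonMatching-uniquelyColoured u v uv Muv u w uw (≡.sym same)
  ...   | inj₁ (_ , w≡v) = v≢w (≡.sym w≡v)
  ...   | inj₂ (u≡v , _) = adj⇒≢ uv u≡v

  colour-onto : Fin n → ∀ i → ∃ λ x → ∃ λ y → Adj G x y × colour x y ≡ i
  colour-onto v zero with exactly-one v
  ... | p , Mvp , _ = v , p , M⊆E v p Mvp , colour-matching {v} {p} Mvp
  colour-onto v (suc j) with ∈-nonMatching⁻ (∈-lookup {xs = nonMatching} j)
  ... | x<y , xy , Mxy = _ , _ , xy , (begin
    colour x y                ≡⟨ colour-nonMatching {x} {y} Mxy ⟩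
    position (sortPair x y)   ≡⟨ cong position (sortPair-of-< x<y) ⟩
    position (lookup nonMatching j) ≡⟨ position-lookup nonMatching-unique j ⟩
    suc j                     ∎)
    where
    open ≡-Reasoning
    x y : Fin n
    x = proj₁ (lookup nonMatching j)
    y = proj₂ (lookup nonMatching j)

  colouring : Fin n → EdgeColoring G (suc (length nonMatching))
  colouring v = record { c = colour ; c-sym = colour-sym ; proper = colour-proper ; onto = colour-onto v }

  colours-bound : suc (length nonMatching) ≤ size G ∸ n / 2 + 1
  colours-bound = begin
    suc K                    ≡⟨ +-comm 1 K ⟩
    K + 1                    ≤⟨ +-monoˡ-≤ 1 (m≤n+m K (X ∸ n / 2)) ⟩
    X ∸ n / 2 + K + 1        ≡⟨ cong (_+ 1) (≡.sym (+-∸-comm K (half-≤ n≤2·matching))) ⟩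
    X + K ∸ n / 2 + 1        ≡⟨ cong (λ s → s ∸ n / 2 + 1) (≡.sym size≡matching+nonMatching) ⟩
    size G ∸ n / 2 + 1       ∎
    where
    open ≤-Reasoning
    X K : ℕ
    X = length matching
    K = length nonMatching

-- Distinguishing vertices

module Locating {n k} (G : Graph n) (pm : PerfectMatching G) (col : EdgeColoring G k)
  (uniquelyColoured : ∀ x y → Adj G x y → PerfectMatching.M pm x y ≡ false → UniquelyColoured G (c col) x y)
  where
  open PerfectMatching pm
  open GraphFacts G

  sameCode-sym : ∀ {u w} → SameCode col u w → SameCode col w u
  sameCode-sym same i d = swap (same i d)

  classDist-incident : ∀ {u z} → Adj G u z → ClassDist col u (c col u z) 0
  classDist-incident uz = (_ , _ , uz , refl , (nil , λ _ ())) , λ _ _ _ _ _ _ → z≤n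

  classDist-adjacent : ∀ {u p z} → Adj G p z → UniquelyColoured G (c col) p z →
                       Adj G u p → u ≢ z → ClassDist col u (c col p z) 1
  classDist-adjacent {u} {p} {z} pz unique up u≢z = (p , z , pz , refl , (cons up nil , no-shortcut)) , nearest
    where
    no-shortcut : ∀ j → j ℕ.< 1 → ¬ Walk G u p j
    no-shortcut zero _ walk = adj⇒≢ up (walk-0 walk)
    no-shortcut (suc _) (s≤s ())
    nearest : ∀ x y j → Adj G x y → c col x y ≡ c col p z → IsDist G u x j → 1 ≤ j
    nearest x y zero xy same (walk , _) with unique x y xy same
    ... | inj₁ (x≡p , _) = ⊥-elim (adj⇒≢ up (trans (walk-0 walk) x≡p))
    ... | inj₂ (x≡z , _) = ⊥-elim (u≢z (trans (walk-0 walk) x≡z))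
    nearest x y (suc j) _ _ _ = s≤s z≤n

  near-endpoint : ∀ {w p z d} → UniquelyColoured G (c col) p z → ClassDist col w (c col p z) d →
                  ∃ λ x → (x ≡ p ⊎ x ≡ z) × Walk G w x d
  near-endpoint unique ((x , y , xy , same , (walk , _)) , _) =
    x , Sum.map proj₁ proj₁ (unique x y xy same) , walk

  twin-neighbour : ∀ {u w z} → SameCode col u w → u ≢ w → Adj G u z → M u z ≡ true ⊎ z ≡ w
  twin-neighbour {u} {w} {z} same u≢w uz with true-or-false (M u z)
  ... | inj₁ Muz = inj₁ Muz
  ... | inj₂ Muz with near-endpoint (uniquelyColoured u z uz Muz) (proj₁ (same _ 0) (classDist-incident uz))
  ...   | x , inj₁ x≡u , walk = ⊥-elim (u≢w (≡.sym (trans (walk-0 walk) x≡u)))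
  ...   | x , inj₂ x≡z , walk = inj₂ (≡.sym (trans (walk-0 walk) x≡z))

  -- u is at distance 1 from the own colour of pz, hence so is w: w is adjacent to p or to z.
  partner-neighbour : ∀ {u w p q z} → SameCode col u w → u ≢ w → M u p ≡ true → M w q ≡ true →
                      Adj G p z → z ≡ u ⊎ z ≡ q
  partner-neighbour {u} {w} {p} {q} {z} same u≢w Mup Mwq pz with true-or-false (M p z)
  ... | inj₁ Mpz = inj₁ (matched-unique pm Mpz (trans (M-sym p u) Mup))
  ... | inj₂ Mpz = reach (near-endpoint unique (proj₁ (same _ 1) (classDist-adjacent pz unique up u≢z)))
    where
    Mpu : M p u ≡ true
    Mpu = trans (M-sym p u) Mup
    up : Adj G u p
    up = M⊆E u p Mup
    unique : UniquelyColoured G (c col) p z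
    unique = uniquelyColoured p z pz Mpz
    u≢z : u ≢ z
    u≢z u≡z with trans (≡.sym Mpu) (trans (cong (M p) u≡z) Mpz)
    ... | ()
    reach : (∃ λ x → (x ≡ p ⊎ x ≡ z) × Walk G w x 1) → z ≡ u ⊎ z ≡ q
    reach (x , inj₁ refl , walk) with twin-neighbour (sameCode-sym same) (u≢w ∘ ≡.sym) (walk-1 walk)
    ... | inj₁ Mwp = ⊥-elim (u≢w (matched-unique pm Mpu (trans (M-sym p w) Mwp)))
    ... | inj₂ p≡u = ⊥-elim (adj⇒≢ up (≡.sym p≡u))
    reach (x , inj₂ refl , walk) with twin-neighbour (sameCode-sym same) (u≢w ∘ ≡.sym) (walk-1 walk)
    ... | inj₁ Mwz = inj₂ (matched-unique pm Mwz Mwq)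
    ... | inj₂ z≡u = ⊥-elim (u≢z (≡.sym z≡u))

  module _ {u w p q} (same : SameCode col u w) (u≢w : u ≢ w) (Mup : M u p ≡ true) (Mwq : M w q ≡ true) where
    twins-and-partners : List (Fin n)
    twins-and-partners = u ∷ w ∷ p ∷ q ∷ []

    twins-and-partners-closed : ∀ {s z} → s ∈ twins-and-partners → Adj G s z → z ∈ twins-and-partners
    twins-and-partners-closed (here refl) sz with twin-neighbour same u≢w sz
    ... | inj₁ Muz = there (there (here (matched-unique pm Muz Mup)))
    ... | inj₂ z≡w = there (here z≡w)
    twins-and-partners-closed (there (here refl)) sz with twin-neighbour (sameCode-sym same) (u≢w ∘ ≡.sym) sz
    ... | inj₁ Mwz = there (there (there (here (matched-unique pm Mwz Mwq))))
    ... | inj₂ z≡u = here z≡u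
    twins-and-partners-closed (there (there (here refl))) sz with partner-neighbour same u≢w Mup Mwq sz
    ... | inj₁ z≡u = here z≡u
    ... | inj₂ z≡q = there (there (there (here z≡q)))
    twins-and-partners-closed (there (there (there (here refl)))) sz
      with partner-neighbour (sameCode-sym same) (u≢w ∘ ≡.sym) Mwq Mup sz
    ... | inj₁ z≡w = there (here z≡w)
    ... | inj₂ z≡p = there (there (here z≡p))

  sameCode⇒≡ : Connected G → 5 ≤ n → ∀ u w → SameCode col u w → u ≡ w
  sameCode⇒≡ connected 5≤n u w same with u Finₚ.≟ w | exactly-one u | exactly-one w
  ... | yes u≡w | _ | _ = u≡w
  ... | no u≢w | p , Mup , _ | q , Mwq , _ = ⊥-elim (1+n≰n (≤-trans 5≤n n≤4))
    where
    n≤4 : n ≤ 4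
    n≤4 = ≤-length-of-cover (twins-and-partners same u≢w Mup Mwq) λ t →
      walk-closed (_∈ twins-and-partners same u≢w Mup Mwq) (twins-and-partners-closed same u≢w Mup Mwq)
                  (proj₂ (connected u t)) (here refl)

χ'L-bound : ∀ n (G : Graph n) → 5 ≤ n → Connected G → PerfectMatching G →
            ∃ λ k → EdgeLocatingColoring G k × k ≤ size G ∸ n / 2 + 1
χ'L-bound n G 5≤n connected pm = suc (length nonMatching) , edgeLocating , colours-bound
  where
  open MatchingColouring G pm
  v₀ : Fin n
  v₀ = fromℕ< (≤-trans (s≤s z≤n) 5≤n)
  edgeLocating : EdgeLocatingColoring G (suc (length nonMatching))
  edgeLocating = record
    { coloring = colouring v₀
    ; locating = Locating.sameCode⇒≡ G pm (colouring v₀) nonMatching-uniquelyColoured connected 5≤n }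

χ'L-exact : ∀ {G : Graph n} {b} → (∃ λ k → EdgeLocatingColoring G k × k ≤ b) →
            (∀ k → EdgeLocatingColoring G k → b ≤ k) → IsEdgeLocatingChromaticIndex G b
χ'L-exact (k , elc , k≤b) lower = subst (EdgeLocatingColoring _) (≤-antisym k≤b (lower k elc)) elc , lower

least : List ℕ → Maybe ℕ
least [] = nothing
least (x ∷ xs) = just (Extrema.min x xs)

IsLeast : ℕ → List ℕ → Set
IsLeast d xs = d ∈ xs × All (d ≤_) xs

least⇒isLeast : ∀ {d} xs → least xs ≡ just d → IsLeast d xs
least⇒isLeast (x ∷ xs) refl = min∈ (Extrema.argmin-sel id x xs) , Extrema.min≤⊤ x xs ∷ Extrema.min≤xs x xs
  where
  min∈ : Extrema.min x xs ≡ x ⊎ Extrema.min x xs ∈ xs → Extrema.min x xs ∈ x ∷ xs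
  min∈ = Sum.[ here , there ]

isLeast⇒least : ∀ {d} xs → IsLeast d xs → least xs ≡ just d
isLeast⇒least {d} (x ∷ xs) (d∈ , d≤x ∷ d≤xs) =
  cong just (≤-antisym (Extrema.min≤v⁺ x xs (Sum.map ≤-of-≡ (Any.map ≤-of-≡) (Any.toSum d∈)))
                       (Extrema.v≤min⁺ d≤x d≤xs))
  where
  ≤-of-≡ : ∀ {y} → d ≡ y → y ≤ d
  ≤-of-≡ d≡y = ≤-reflexive (≡.sym d≡y)

-- Small graphs, decided by evaluation

∀-vec? : ∀ m {P : Vec (Fin k) m → Set} → (∀ t → Dec (P t)) → Dec (∀ t → P t)
∀-vec? zero P? = map′ (λ P[] → λ { [] → P[] }) (λ all → all []) (P? [])
∀-vec? (suc m) P? =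
  map′ (λ all → λ { (a ∷ t) → all a t }) (λ all a t → all (a ∷ t)) (Finₚ.all? λ a → ∀-vec? m (P? ∘ (a ∷_)))

module _ {n} (G : Graph n) where
  Adj? : ∀ x y → Dec (Adj G x y)
  Adj? x y = E G x y Bool.≟ true

  DistanceCertificate : (Fin n → Fin n → ℕ) → Set
  DistanceCertificate D =
    (∀ a b → D a b ≡ 0 → a ≡ b) × (∀ a → D a a ≡ 0) ×
    (∀ a a' b → Adj G a a' → D a b ≤ suc (D a' b)) ×
    (∀ a b → D a b ≡ 0 ⊎ ∃ λ a' → Adj G a a' × suc (D a' b) ≡ D a b)

  distanceCertificate? : ∀ D → Dec (DistanceCertificate D)
  distanceCertificate? D =
    (Finₚ.all? λ a → Finₚ.all? λ b → (D a b ℕ.≟ 0) →-dec (a Finₚ.≟ b)) ×-dec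
    (Finₚ.all? λ a → D a a ℕ.≟ 0) ×-dec
    (Finₚ.all? λ a → Finₚ.all? λ a' → Finₚ.all? λ b → Adj? a a' →-dec (D a b ℕ.≤? suc (D a' b))) ×-dec
    (Finₚ.all? λ a → Finₚ.all? λ b →
      (D a b ℕ.≟ 0) ⊎-dec Finₚ.any? λ a' → Adj? a a' ×-dec (suc (D a' b) ℕ.≟ D a b))

  isDist-of-certificate : ∀ {D} → DistanceCertificate D → ∀ a b → IsDist G a b (D a b)
  isDist-of-certificate {D} (zero⇒≡ , D-refl , D-step , D-descent) a b = walk (D a b) a b refl , shortest
    where
    walk : ∀ k a b → D a b ≡ k → Walk G a b k
    walk zero a b Dab≡0 rewrite zero⇒≡ a b Dab≡0 = nil
    walk (suc k) a b Dab≡k with D-descent a b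
    ... | inj₁ Dab≡0 = ⊥-elim (ℕₚ.0≢1+n (trans (≡.sym Dab≡0) Dab≡k))
    ... | inj₂ (a' , aa' , desc) = cons aa' (walk k a' b (ℕₚ.suc-injective (trans desc Dab≡k)))

    D≤length : ∀ {a j} → Walk G a b j → D a b ≤ j
    D≤length {a} nil = ≤-reflexive (D-refl a)
    D≤length (cons aa' w) = ≤-trans (D-step _ _ b aa') (s≤s (D≤length w))

    shortest : ∀ j → j ℕ.< D a b → ¬ Walk G a b j
    shortest j j<D w = ℕₚ.<⇒≱ j<D (D≤length w)

  connected-of-distance : {D : Fin n → Fin n → ℕ} → (∀ a b → IsDist G a b (D a b)) → Connected G
  connected-of-distance {D} isDist a b = D a b , proj₁ (isDist a b)

  IsPerfectMatching : (Fin n → Fin n → Bool) → Set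
  IsPerfectMatching M =
    (∀ u v → M u v ≡ M v u) × (∀ u v → M u v ≡ true → Adj G u v) ×
    (∀ v → ∃ λ u → (M v u ≡ true) × (∀ w → M v w ≡ true → w ≡ u))

  isPerfectMatching? : ∀ M → Dec (IsPerfectMatching M)
  isPerfectMatching? M =
    (Finₚ.all? λ u → Finₚ.all? λ v → M u v Bool.≟ M v u) ×-dec
    (Finₚ.all? λ u → Finₚ.all? λ v → (M u v Bool.≟ true) →-dec Adj? u v) ×-dec
    (Finₚ.all? λ v → Finₚ.any? λ u → (M v u Bool.≟ true) ×-dec
      Finₚ.all? λ w → (M v w Bool.≟ true) →-dec (w Finₚ.≟ u))

  perfectMatching : ∀ {M} → IsPerfectMatching M → PerfectMatching G
  perfectMatching {M} (M-sym , M⊆E , exactly-one) =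
    record { M = M ; M-sym = M-sym ; M⊆E = M⊆E ; exactly-one = exactly-one }

arc : Fin n × Fin n → Fin 2 → Fin n × Fin n
arc p zero = p
arc p (suc zero) = swap p

Enumerates : ∀ {m} → Graph n → (Fin m → Fin n × Fin n) → Set
Enumerates G ends =
  (∀ e → uncurry (Adj G) (ends e)) × (∀ x y → Adj G x y → ∃ λ e → ∃ λ s → arc (ends e) s ≡ (x , y))

enumerates? : ∀ {m} (G : Graph n) (ends : Fin m → Fin n × Fin n) → Dec (Enumerates G ends)
enumerates? G ends =
  (Finₚ.all? λ e → uncurry (Adj? G) (ends e)) ×-dec
  (Finₚ.all? λ x → Finₚ.all? λ y → Adj? G x y →-dec
    Finₚ.any? λ e → Finₚ.any? λ s → Product.≡-dec Finₚ._≟_ Finₚ._≟_ (arc (ends e) s) (x , y))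

-- Colourings of the listed edges are searched exhaustively; the class distances of a
-- vertex are the distances to the tails of the arcs of each colour.
module ExhaustiveSearch {n m} (G : Graph n) (ends : Fin m → Fin n × Fin n) (enumerates : Enumerates G ends)
  (D : Fin n → Fin n → ℕ) (isDist : ∀ a b → IsDist G a b (D a b)) where
  open GraphFacts G

  tail : Fin m × Fin 2 → Fin n
  tail (e , s) = proj₁ (arc (ends e) s)

  arc-adj : ∀ e s → uncurry (Adj G) (arc (ends e) s)
  arc-adj e zero = proj₁ enumerates e
  arc-adj e (suc zero) = adj-sym (proj₁ enumerates e)

  halfEdges : List (Fin m × Fin 2)
  halfEdges = cartesianProduct (allFin m) (allFin 2)

  module _ {k} (t : Vec (Fin k) m) where
    Proper : Set
    Proper = ∀ e s e' s' → proj₁ (arc (ends e) s) ≡ proj₁ (arc (ends e') s') →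
             proj₂ (arc (ends e) s) ≢ proj₂ (arc (ends e') s') → Vec.lookup t e ≢ Vec.lookup t e'

    proper? : Dec Proper
    proper? =
      Finₚ.all? λ e → Finₚ.all? λ s → Finₚ.all? λ e' → Finₚ.all? λ s' →
        (proj₁ (arc (ends e) s) Finₚ.≟ proj₁ (arc (ends e') s')) →-dec
        (¬? (proj₂ (arc (ends e) s) Finₚ.≟ proj₂ (arc (ends e') s')) →-dec
        ¬? (Vec.lookup t e Finₚ.≟ Vec.lookup t e'))

    classDistances : Fin n → Fin k → List ℕ
    classDistances v i =
      map (D v ∘ tail) (filter (λ (e , _) → Vec.lookup t e Finₚ.≟ i) halfEdges)

    ∈-classDistances⁻ : ∀ {v i x} → x ∈ classDistances v i →
                        ∃ λ h → Vec.lookup t (proj₁ h) ≡ i × x ≡ D v (tail h)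
    ∈-classDistances⁻ x∈ with ∈-map⁻ (D _ ∘ tail) x∈
    ... | h , h∈ , x≡ = h , proj₂ (∈-filter⁻ (λ (e , _) → Vec.lookup t e Finₚ.≟ _) {xs = halfEdges} h∈) , x≡

    ∈-classDistances⁺ : ∀ {v i} e s → Vec.lookup t e ≡ i → D v (tail (e , s)) ∈ classDistances v i
    ∈-classDistances⁺ {v} {i} e s coloured-i = ∈-map⁺ (D v ∘ tail)
      (∈-filter⁺ (λ (e , _) → Vec.lookup t e Finₚ.≟ i) (∈-cartesianProduct⁺ (∈-allFin e) (∈-allFin s)) coloured-i)

    Locating : Set
    Locating = ∀ u w → (∀ i → least (classDistances u i) ≡ least (classDistances w i)) → u ≡ w

    locating? : Dec Locating
    locating? =
      Finₚ.all? λ u → Finₚ.all? λ w →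
        (Finₚ.all? λ i → Maybe.≡-dec ℕ._≟_ (least (classDistances u i)) (least (classDistances w i))) →-dec
        (u Finₚ.≟ w)

  NoLocatingColouring : ℕ → Set
  NoLocatingColouring k = ∀ (t : Vec (Fin k) m) → Proper t → ¬ Locating t

  noLocatingColouring? : ∀ k → Dec (NoLocatingColouring k)
  noLocatingColouring? k = ∀-vec? m λ t → proper? t →-dec ¬? (locating? t)

  module _ {k} (col : EdgeColoring G k) where
    colours : Vec (Fin k) m
    colours = Vec.tabulate (uncurry (c col) ∘ ends)

    colours-arc : ∀ e s → Vec.lookup colours e ≡ uncurry (c col) (arc (ends e) s)
    colours-arc e zero = Vecₚ.lookup∘tabulate _ e
    colours-arc e (suc zero) = trans (Vecₚ.lookup∘tabulate _ e) (c-sym col _ _ (proj₁ enumerates e))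

    colours-proper : Proper colours
    colours-proper e s e' s' tails heads same =
      proper col _ _ _ heads (arc-adj e s) (subst (λ x → Adj G x _) (≡.sym tails) (arc-adj e' s'))
        (trans (≡.sym (colours-arc e s)) (trans same (trans (colours-arc e' s') (cong (λ x → c col x _) (≡.sym tails)))))

    edge-∈-classDistances : ∀ {v i x y} → Adj G x y → c col x y ≡ i → D v x ∈ classDistances colours v i
    edge-∈-classDistances {x = x} {y} xy coloured-i with proj₂ enumerates x y xy
    ... | e , s , refl = ∈-classDistances⁺ colours e s (trans (colours-arc e s) coloured-i)

    classDist⇒isLeast : ∀ {v i d} → ClassDist col v i d → IsLeast d (classDistances colours v i)
    classDist⇒isLeast {v} {i} {d} ((x , y , xy , coloured-i , dist) , nearest) =
      subst (_∈ _) (isDist-unique (isDist v x) dist) (edge-∈-classDistances xy coloured-i) ,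
      All.tabulate d≤
      where
      d≤ : ∀ {z} → z ∈ classDistances colours v i → d ≤ z
      d≤ z∈ with ∈-classDistances⁻ colours z∈
      ... | (e , s) , coloured-i , refl =
        nearest _ _ _ (arc-adj e s) (trans (≡.sym (colours-arc e s)) coloured-i) (isDist v _)

    isLeast⇒classDist : ∀ {v i d} → IsLeast d (classDistances colours v i) → ClassDist col v i d
    isLeast⇒classDist {v} {i} {d} (d∈ , d≤) with ∈-classDistances⁻ colours d∈
    ... | (e , s) , coloured-i , refl =
      (_ , _ , arc-adj e s , trans (≡.sym (colours-arc e s)) coloured-i , isDist v _) ,
      λ x y j xy coloured-i dist →
        subst (_ ≤_) (isDist-unique (isDist v x) dist) (All.lookup d≤ (edge-∈-classDistances xy coloured-i))

    colours-locating : (∀ u w → SameCode col u w → u ≡ w) → Locating colours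
    colours-locating locating u w same-least = locating u w λ i d →
      (isLeast⇒classDist ∘ transfer (same-least i) ∘ classDist⇒isLeast) ,
      (isLeast⇒classDist ∘ transfer (≡.sym (same-least i)) ∘ classDist⇒isLeast)
      where
      transfer : ∀ {xs ys d} → least xs ≡ least ys → IsLeast d xs → IsLeast d ys
      transfer {xs} {ys} same = least⇒isLeast ys ∘ trans (≡.sym same) ∘ isLeast⇒least xs

  no-edgeLocating : ∀ {k} → NoLocatingColouring k → ¬ EdgeLocatingColoring G k
  no-edgeLocating none elc = none (colours coloring) (colours-proper coloring) (colours-locating coloring locating)
    where open EdgeLocatingColoring elc

  lower-bound : ∀ b → (∀ (k : Fin b) → NoLocatingColouring (toℕ k)) → ∀ k → EdgeLocatingColoring G k → b ≤ k
  lower-bound b none k elc =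
    ℕₚ.≮⇒≥ λ k<b → no-edgeLocating (subst NoLocatingColouring (Finₚ.toℕ-fromℕ< k<b) (none (fromℕ< k<b))) elc

C₆-edges : Fin 6 → Fin 6 × Fin 6
C₆-edges = Vec.lookup ((# 0 , # 1) ∷ (# 1 , # 2) ∷ (# 2 , # 3) ∷ (# 3 , # 4) ∷ (# 4 , # 5) ∷ (# 5 , # 0) ∷ [])

P₆-edges : Fin 5 → Fin 6 × Fin 6
P₆-edges = Vec.lookup ((# 0 , # 1) ∷ (# 1 , # 2) ∷ (# 2 , # 3) ∷ (# 3 , # 4) ∷ (# 4 , # 5) ∷ [])

P₆-distance C₆-distance : Fin 6 → Fin 6 → ℕ
P₆-distance a b = ℕ.∣ toℕ a - toℕ b ∣
C₆-distance a b = P₆-distance a b ℕ.⊓ (6 ∸ P₆-distance a b)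

-- the edges 01, 23 and 45
pairing : Fin 6 → Fin 6 → Bool
pairing u v = (toℕ u / 2 ℕ.≡ᵇ toℕ v / 2) ∧ not (toℕ u ℕ.≡ᵇ toℕ v)

5≤6 : 5 ≤ 6
5≤6 = ℕₚ.n≤1+n 5

C₆-isDist : ∀ a b → IsDist C₆ a b (C₆-distance a b)
C₆-isDist = isDist-of-certificate C₆ (from-yes (distanceCertificate? C₆ C₆-distance))

P₆-isDist : ∀ a b → IsDist P₆ a b (P₆-distance a b)
P₆-isDist = isDist-of-certificate P₆ (from-yes (distanceCertificate? P₆ P₆-distance))

χ'L-C₆ : IsEdgeLocatingChromaticIndex C₆ 4
χ'L-C₆ = χ'L-exact (χ'L-bound 6 C₆ 5≤6 (connected-of-distance C₆ C₆-isDist) matching) lower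
  where
  open ExhaustiveSearch C₆ C₆-edges (from-yes (enumerates? C₆ C₆-edges)) C₆-distance C₆-isDist
  matching : PerfectMatching C₆
  matching = perfectMatching C₆ (from-yes (isPerfectMatching? C₆ pairing))
  lower : ∀ k → EdgeLocatingColoring C₆ k → 4 ≤ k
  lower = lower-bound 4 (from-yes (Finₚ.all? {n = 4} λ k → noLocatingColouring? (toℕ k)))

χ'L-P₆ : IsEdgeLocatingChromaticIndex P₆ 3
χ'L-P₆ = χ'L-exact (χ'L-bound 6 P₆ 5≤6 (connected-of-distance P₆ P₆-isDist) matching) lower
  where
  open ExhaustiveSearch P₆ P₆-edges (from-yes (enumerates? P₆ P₆-edges)) P₆-distance P₆-isDist
  matching : PerfectMatching P₆
  matching = perfectMatching P₆ (from-yes (isPerfectMatching? P₆ pairing))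
  lower : ∀ k → EdgeLocatingColoring P₆ k → 3 ≤ k
  lower = lower-bound 3 (from-yes (Finₚ.all? {n = 3} λ k → noLocatingColouring? (toℕ k)))

theorem13 : (∀ (n : ℕ) (G : Graph n) → 5 ≤ n → Connected G → PerfectMatching G →
               ∃ λ k → EdgeLocatingColoring G k × k ≤ size G ∸ n / 2 + 1)
            × IsEdgeLocatingChromaticIndex C₆ (size C₆ ∸ 6 / 2 + 1)
            × IsEdgeLocatingChromaticIndex P₆ (size P₆ ∸ 6 / 2 + 1)
theorem13 = χ'L-bound , χ'L-C₆ , χ'L-P₆
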